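{- Let $G$ be a graph, let $S=\{B_i=B_{r_i}(s_i)\}_{i\in[n]}$ be a set of $n$ pairwise incomparable balls in $G$ with pairwise distinct centers $s_1,\dots,s_n$, and let $E_S\subseteq\binom{S}{2}$ be a set of pairs $\{B_i,B_j\}$ of intersecting balls of $S$, each of which is associated with a median vertex $x_{\{i,j\}}$ of $B_i$ and $B_j$ such that the only balls of $S$ containing $x_{\{i,j\}}$ are $B_i$ and $B_j$. Then the graph $H=(S,E_S)$ is a minor of $G$.
   Context: Graphs are finite; $d_G$ denotes shortest-path distance. A ball $B_r(v)$ (center $v\in V(G)$, integer radius $r\ge 0$) is the set $\{u: d_G(u,v)\le r\}$. Two balls $B_1,B_2$ are comparable if $B_1\subsetneq B_2$ or $B_2\subsetneq B_1$, and incomparable otherwise (so equal balls are incomparable). For two intersecting incomparable balls $B_1=B_{r_1}(v_1)$, $B_2=B_{r_2}(v_2)$ with $d=d_G(v_1,v_2)$, a median vertex of $B_1$ and $B_2$ is any vertex $u$ lying on a shortest path between $v_1$ and $v_2$ with either $d_G(v_1,u)=\lfloor\frac{r_1-r_2+d}{2}\rfloor$ and $d_G(v_2,u)=\lceil\frac{r_2-r_1+d}{2}\rceil$, or $d_G(v_1,u)=\lceil\frac{r_1-r_2+d}{2}\rceil$ and $d_G(v_2,u)=\lfloor\frac{r_2-r_1+d}{2}\rfloor$. -}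

module Defs where

open import Level using (0ℓ)
open import Data.Nat using (ℕ; zero; suc; _+_; _≤_)
open import Data.Fin using (Fin)
open import Data.Integer as ℤ using (ℤ; +_; -_; _/ℕ_)
open import Data.Product using (Σ; ∃; _×_; _,_)
open import Data.Sum using (_⊎_)
open import Relation.Nullary using (¬_)
open import Relation.Binary.PropositionalEquality using (_≡_; _≢_)

record Graph : Set₁ where
  field
    N      : ℕ
    _~_    : Fin N → Fin N → Set
    ~-sym  : ∀ {u v} → u ~ v → v ~ u
    ~-irr  : ∀ {u} → ¬ (u ~ u)
open Graph public

module _ (G : Graph) where
  private
    V = Fin (N G)
    _∼_ = _~_ G

  data Walk : V → V → ℕ → Set where
    [] : ∀ {u} → Walk u u 0
    _∷_ : ∀ {u v w k} → u ∼ v → Walk v w k → Walk u w (suc k)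

  Dist : V → V → ℕ → Set
  Dist u v k = Walk u v k × (∀ m → Walk u v m → k ≤ m)

  InBall : V → ℕ → V → Set
  InBall c r u = ∃ λ k → Dist c u k × k ≤ r

  _⊆B_ : V × ℕ → V × ℕ → Set
  (c₁ , r₁) ⊆B (c₂ , r₂) = ∀ u → InBall c₁ r₁ u → InBall c₂ r₂ u

  _⊊B_ : V × ℕ → V × ℕ → Set
  B₁ ⊊B B₂ = B₁ ⊆B B₂ × ¬ (B₂ ⊆B B₁)

  Comparable : V × ℕ → V × ℕ → Set
  Comparable B₁ B₂ = B₁ ⊊B B₂ ⊎ B₂ ⊊B B₁

  Incomparable : V × ℕ → V × ℕ → Set
  Incomparable B₁ B₂ = ¬ Comparable B₁ B₂

  Intersecting : V × ℕ → V × ℕ → Set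
  Intersecting (c₁ , r₁) (c₂ , r₂) = ∃ λ u → InBall c₁ r₁ u × InBall c₂ r₂ u

  data WalkIn (P : V → Set) : V → V → Set where
    [] : ∀ {u} → P u → WalkIn P u u
    _∷_ : ∀ {u v w} → P u → u ∼ v → WalkIn P v w → WalkIn P u w

⌊_/2⌋ : ℤ → ℤ
⌊ x /2⌋ = x /ℕ 2

⌈_/2⌉ : ℤ → ℤ
⌈ x /2⌉ = - ((- x) /ℕ 2)

-- u is a median vertex of B_r1(c1) and B_r2(c2)
-- (the balls are assumed intersecting and incomparable by the caller)
IsMedian : (G : Graph) → Fin (N G) × ℕ → Fin (N G) × ℕ → Fin (N G) → Set
IsMedian G (c₁ , r₁) (c₂ , r₂) u =
  Σ ℕ λ d → Σ ℕ λ d₁ → Σ ℕ λ d₂ →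
    Dist G c₁ c₂ d × Dist G c₁ u d₁ × Dist G c₂ u d₂ ×
    d₁ + d₂ ≡ d ×
    ( (+ d₁ ≡ ⌊ (+ r₁ ℤ.- + r₂) ℤ.+ + d /2⌋ × + d₂ ≡ ⌈ (+ r₂ ℤ.- + r₁) ℤ.+ + d /2⌉)
    ⊎ (+ d₁ ≡ ⌈ (+ r₁ ℤ.- + r₂) ℤ.+ + d /2⌉ × + d₂ ≡ ⌊ (+ r₂ ℤ.- + r₁) ℤ.+ + d /2⌋))

IsMinor : Graph → Graph → Set₁
IsMinor H G =
  Σ (Fin (N H) → Fin (N G) → Set) λ β →
    (∀ h → ∃ λ v → β h v) ×
    (∀ h h' v → β h v → β h' v → h ≡ h') ×
    (∀ h u v → β h u → β h v → WalkIn G (β h) u v) ×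
    (∀ h h' → _~_ H h h' → ∃ λ u → ∃ λ v → β h u × β h' v × _~_ G u v)

mkGraph : (n : ℕ) (E : Fin n → Fin n → Set) →
          (∀ {i j} → E i j → E j i) → (∀ {i} → ¬ E i i) → Graph
mkGraph n E s irr = record { N = n ; _~_ = E ; ~-sym = s ; ~-irr = irr }

module Submission where

-- Ball i gets as branch set its centre s_i and, for each pair {i,j} of E_S with median x,
-- a geodesic from s_i towards x, where x goes to exactly one of i and j. Every vertex so
-- assigned to i lies in the cell of i: it minimises d(s_k,v) − r_k over all k (ties broken
-- by index), or it is s_i. The choice of x as a median balances d(s_i,v) − r_i against
-- d(s_j,v) − r_j along the geodesic; any other ball B_k closer to such a vertex would
-- contain x, and a centre s_k on the geodesic would give B_k ⊊ B_i, with x witnessing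
-- properness. Cells are disjoint, branch sets are connected through their centres, and the
-- last edge of a geodesic into x joins the branch sets of i and j.

open import Defs
open import Data.Nat using (ℕ; zero; suc; _+_; _∸_; _≤_; _<_; z≤n; s≤s)
open import Data.Nat.Properties
open import Relation.Binary.Definitions using (tri<; tri≈; tri>)
open import Data.Nat.Induction using (<-rec)
open import Data.Fin using (Fin; toℕ)
open import Data.Fin.Properties using (toℕ-injective) renaming (_≟_ to _≟ᶠ_)
open import Data.Product using (Σ; ∃; _×_; _,_; proj₁; proj₂)
open import Data.Sum using (_⊎_; inj₁; inj₂; [_,_]′)
open import Data.Empty using (⊥-elim)
open import Relation.Nullary using (¬_; yes; no)
open import Relation.Nullary.Decidable using (decidable-stable)
open import Data.Integer as ℤ using (ℤ; +_; -_; 1ℤ; _/ℕ_)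
import Data.Integer.Properties as ℤ
open import Data.Integer.DivMod using ([n/ℕd]*d≤n; n<s[n/ℕd]*d)
open import Data.Integer.Tactic.RingSolver using (solve-∀)
open import Relation.Binary.PropositionalEquality
  using (_≡_; _≢_; refl; sym; trans; cong; subst; subst₂; ≢-sym)

∀-¬¬-Fin : ∀ {m} {P : Fin m → Set} → (∀ i → ¬ ¬ P i) → ¬ ¬ (∀ i → P i)
∀-¬¬-Fin {zero}  _   ¬∀ = ¬∀ λ ()
∀-¬¬-Fin {suc m} ¬¬P ¬∀ = ¬¬P Fin.zero λ P₀ →
  ∀-¬¬-Fin (λ i → ¬¬P (Fin.suc i)) λ P₊ → ¬∀ λ { Fin.zero → P₀ ; (Fin.suc i) → P₊ i }
  where import Data.Fin as Fin

→-¬¬ : ∀ {A B : Set} → (A → ¬ ¬ B) → ¬ ¬ (A → B)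
→-¬¬ f ¬→ = ¬→ λ a → ⊥-elim (f a λ b → ¬→ λ _ → b)

module Walks (G : Graph) where

  private
    V = Fin (N G)
    _∼_ = _~_ G

  infixr 5 _++_

  _++_ : ∀ {u v w k l} → Walk G u v k → Walk G v w l → Walk G u w (k + l)
  []      ++ q = q
  (e ∷ p) ++ q = e ∷ (p ++ q)

  _∷ʳ_ : ∀ {u v w k} → Walk G u v k → v ∼ w → Walk G u w (suc k)
  []      ∷ʳ e′ = e′ ∷ []
  (e ∷ p) ∷ʳ e′ = e ∷ (p ∷ʳ e′)

  reverse : ∀ {u v k} → Walk G u v k → Walk G v u k
  reverse []      = []
  reverse (e ∷ p) = reverse p ∷ʳ ~-sym G e

  at : ∀ {u v k} → Walk G u v k → ℕ → V
  at {u} []      _       = u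
  at {u} (_ ∷ _) zero    = u
  at     (_ ∷ p) (suc t) = at p t

  at-end : ∀ {u v k} (p : Walk G u v k) → at p k ≡ v
  at-end []      = refl
  at-end (_ ∷ p) = at-end p

  prefix : ∀ {u v k} (p : Walk G u v k) t → t ≤ k → Walk G u (at p t) t
  prefix []      zero    _         = []
  prefix (_ ∷ _) zero    _         = []
  prefix (e ∷ p) (suc t) (s≤s t≤k) = e ∷ prefix p t t≤k

  suffix : ∀ {u v k} (p : Walk G u v k) t → t ≤ k → Walk G (at p t) v (k ∸ t)
  suffix []      zero    _         = []
  suffix (e ∷ p) zero    _         = e ∷ p
  suffix (_ ∷ p) (suc t) (s≤s t≤k) = suffix p t t≤k

  last-edge : ∀ {u v k} (p : Walk G u v (suc k)) → at p k ∼ v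
  last-edge (e ∷ [])      = e
  last-edge (_ ∷ (e ∷ p)) = last-edge (e ∷ p)

  penultimate : ∀ {u v k} (p : Walk G u v k) → u ≢ v → ∃ λ t → t < k × at p t ∼ v
  penultimate []      u≢u = ⊥-elim (u≢u refl)
  penultimate (e ∷ p) _   = _ , ≤-refl , last-edge (e ∷ p)

  ≡⇒Dist0 : ∀ {u v} → u ≡ v → Dist G u v 0
  ≡⇒Dist0 refl = [] , λ _ _ → z≤n

  Dist-unique : ∀ {u v k l} → Dist G u v k → Dist G u v l → k ≡ l
  Dist-unique (p , p-min) (q , q-min) = ≤-antisym (p-min _ q) (q-min _ p)

  Dist-prefix : ∀ {u v k} (D : Dist G u v k) t (t≤k : t ≤ k) → Dist G u (at (proj₁ D) t) t
  Dist-prefix {k = k} (p , p-min) t t≤k = prefix p t t≤k , λ m q →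
    +-cancelʳ-≤ (k ∸ t) t m
      (subst (_≤ m + (k ∸ t)) (sym (m+[n∸m]≡n t≤k)) (p-min _ (q ++ suffix p t t≤k)))

  -- Adjacency is not decidable, so shortest walks exist only up to double negation;
  -- every use below concludes ⊥ or a decidable statement.
  shortest-walk : ∀ {u v k} → Walk G u v k → ¬ ¬ (∃ λ m → m ≤ k × Dist G u v m)
  shortest-walk {k = k} = <-rec P shorten k
    where
    P : ℕ → Set
    P k = ∀ {u v} → Walk G u v k → ¬ ¬ (∃ λ m → m ≤ k × Dist G u v m)
    shorten : ∀ k → (∀ {l} → l < k → P l) → P k
    shorten k rec p none = none (k , ≤-refl , p , minimal)
      where
      minimal : ∀ m → Walk G _ _ m → k ≤ m
      minimal m q with m <? k
      ... | no  m≮k = ≮⇒≥ m≮k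
      ... | yes m<k = ⊥-elim (rec m<k q λ (l , l≤m , D) →
                        none (l , ≤-trans l≤m (<⇒≤ m<k) , D))

  walk⇒¬¬InBall : ∀ {c u r k} → Walk G c u k → k ≤ r → ¬ ¬ InBall G c r u
  walk⇒¬¬InBall p k≤r ¬in = shortest-walk p λ (m , m≤k , D) → ¬in (m , D , ≤-trans m≤k k≤r)

  walk⇒¬¬⊆B : ∀ {c c′ r r′ l} → Walk G c c′ l → l + r′ ≤ r → ¬ ¬ _⊆B_ G (c′ , r′) (c , r)
  walk⇒¬¬⊆B p l+r′≤r = ∀-¬¬-Fin λ u → →-¬¬ λ (a , D , a≤r′) →
    walk⇒¬¬InBall (p ++ proj₁ D) (≤-trans (+-monoʳ-≤ _ a≤r′) l+r′≤r)

  walk⇒¬¬⊊B : ∀ {c c′ r r′ l u} → Walk G c c′ l → l + r′ ≤ r →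
              InBall G c r u → ¬ InBall G c′ r′ u → ¬ ¬ _⊊B_ G (c′ , r′) (c , r)
  walk⇒¬¬⊊B p l+r′≤r u∈B u∉B′ ¬⊊ =
    walk⇒¬¬⊆B p l+r′≤r λ B′⊆B → ¬⊊ (B′⊆B , λ B⊆B′ → u∉B′ (B⊆B′ _ u∈B))

  snoc-in : ∀ {P u v w} → WalkIn G P u v → v ∼ w → P w → WalkIn G P u w
  snoc-in ([] Pu)       e′ Pw = _∷_ Pu e′ ([] Pw)
  snoc-in (_∷_ Pu e p) e′ Pw = _∷_ Pu e (snoc-in p e′ Pw)

  reverse-in : ∀ {P u v} → WalkIn G P u v → WalkIn G P v u
  reverse-in ([] Pu)       = [] Pu
  reverse-in (_∷_ Pu e p) = snoc-in (reverse-in p) (~-sym G e) Pu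

  ++-in : ∀ {P u v w} → WalkIn G P u v → WalkIn G P v w → WalkIn G P u w
  ++-in ([] _)        q = q
  ++-in (_∷_ Pu e p) q = _∷_ Pu e (++-in p q)

  prefix-in : ∀ {P u v k} (p : Walk G u v k) t → t ≤ k →
              (∀ t′ → t′ ≤ t → P (at p t′)) → WalkIn G P u (at p t)
  prefix-in []      zero    _         P-at = [] (P-at 0 z≤n)
  prefix-in (_ ∷ _) zero    _         P-at = [] (P-at 0 z≤n)
  prefix-in (e ∷ p) (suc t) (s≤s t≤k) P-at =
    _∷_ (P-at 0 z≤n) e (prefix-in p t t≤k λ t′ t′≤t → P-at (suc t′) (s≤s t′≤t))

NearHalf : ℤ → ℤ → Set
NearHalf q z = q ℤ.+ q ℤ.≤ 1ℤ ℤ.+ z × z ℤ.≤ 1ℤ ℤ.+ (q ℤ.+ q)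

⌊/2⌋-NearHalf : ∀ z → NearHalf ⌊ z /2⌋ z
⌊/2⌋-NearHalf z =
  ℤ.≤-trans (subst (ℤ._≤ z) (double q) ([n/ℕd]*d≤n z 2)) (ℤ.i≤suc[i] z) ,
  subst (z ℤ.≤_) (pred-double q) (ℤ.i<j⇒i≤pred[j] (n<s[n/ℕd]*d z 2))
  where
  q : ℤ
  q = z /ℕ 2
  double : ∀ i → i ℤ.* + 2 ≡ i ℤ.+ i
  double = solve-∀
  pred-double : ∀ i → ℤ.-1ℤ ℤ.+ ((1ℤ ℤ.+ i) ℤ.* + 2) ≡ 1ℤ ℤ.+ (i ℤ.+ i)
  pred-double = solve-∀

NearHalf-neg : ∀ {q z} → NearHalf q z → NearHalf (- q) (- z)
NearHalf-neg {q} {z} (lower , upper) =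
  subst (ℤ._≤ 1ℤ ℤ.+ - z) (neg-suc-double q) (ℤ.+-monoʳ-≤ 1ℤ (ℤ.neg-mono-≤ upper)) ,
  subst₂ ℤ._≤_ (neg-suc z) (neg-double q) (ℤ.+-monoʳ-≤ 1ℤ (ℤ.neg-mono-≤ lower))
  where
  neg-suc : ∀ i → 1ℤ ℤ.+ - (1ℤ ℤ.+ i) ≡ - i
  neg-suc = solve-∀
  neg-suc-double : ∀ i → 1ℤ ℤ.+ - (1ℤ ℤ.+ (i ℤ.+ i)) ≡ - i ℤ.+ - i
  neg-suc-double = solve-∀
  neg-double : ∀ i → 1ℤ ℤ.+ - (i ℤ.+ i) ≡ 1ℤ ℤ.+ (- i ℤ.+ - i)
  neg-double = solve-∀

⌈/2⌉-NearHalf : ∀ z → NearHalf ⌈ z /2⌉ z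
⌈/2⌉-NearHalf z =
  subst (NearHalf ⌈ z /2⌉) (ℤ.neg-involutive z) (NearHalf-neg {⌊ - z /2⌋} (⌊/2⌋-NearHalf (- z)))

translate-≤ : ∀ {x y : ℤ} c {m n} → x ℤ.≤ y → x ℤ.+ c ≡ + m → y ℤ.+ c ≡ + n → m ≤ n
translate-≤ c x≤y x+c≡m y+c≡n = ℤ.drop‿+≤+ (subst₂ ℤ._≤_ x+c≡m y+c≡n (ℤ.+-monoˡ-≤ c x≤y))

NearHalf⇒balanced : ∀ d₁ d₂ r₁ r₂ → NearHalf (+ d₁) ((+ r₁ ℤ.- + r₂) ℤ.+ + (d₁ + d₂)) →
                    d₁ + r₂ ≤ suc (d₂ + r₁) × d₂ + r₁ ≤ suc (d₁ + r₂)
NearHalf⇒balanced d₁ d₂ r₁ r₂ near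
  with lower , upper ← subst (λ d → NearHalf (+ d₁) ((+ r₁ ℤ.- + r₂) ℤ.+ d)) (ℤ.pos-+ d₁ d₂) near =
  translate-≤ c lower (trans (e₁ (+ d₁) (+ r₂)) (sym (ℤ.pos-+ d₁ r₂)))
                      (trans (e₂ (+ d₁) (+ d₂) (+ r₁) (+ r₂)) (cong ℤ.suc (sym (ℤ.pos-+ d₂ r₁)))) ,
  translate-≤ c upper (trans (e₃ (+ d₁) (+ d₂) (+ r₁) (+ r₂)) (sym (ℤ.pos-+ d₂ r₁)))
                      (trans (e₄ (+ d₁) (+ r₂)) (cong ℤ.suc (sym (ℤ.pos-+ d₁ r₂))))
  where
  c : ℤ
  c = + r₂ ℤ.- + d₁
  e₁ : ∀ D₁ R₂ → (D₁ ℤ.+ D₁) ℤ.+ (R₂ ℤ.- D₁) ≡ D₁ ℤ.+ R₂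
  e₁ = solve-∀
  e₂ : ∀ D₁ D₂ R₁ R₂ → (1ℤ ℤ.+ ((R₁ ℤ.- R₂) ℤ.+ (D₁ ℤ.+ D₂))) ℤ.+ (R₂ ℤ.- D₁) ≡ 1ℤ ℤ.+ (D₂ ℤ.+ R₁)
  e₂ = solve-∀
  e₃ : ∀ D₁ D₂ R₁ R₂ → ((R₁ ℤ.- R₂) ℤ.+ (D₁ ℤ.+ D₂)) ℤ.+ (R₂ ℤ.- D₁) ≡ D₂ ℤ.+ R₁
  e₃ = solve-∀
  e₄ : ∀ D₁ R₂ → (1ℤ ℤ.+ (D₁ ℤ.+ D₁)) ℤ.+ (R₂ ℤ.- D₁) ≡ 1ℤ ℤ.+ (D₁ ℤ.+ R₂)
  e₄ = solve-∀

balanced⇒≤radius : ∀ {d₁ d₂ r₁ r₂} → d₁ + d₂ ≤ r₁ + r₂ → d₁ + r₂ ≤ suc (d₂ + r₁) → d₁ ≤ r₁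
balanced⇒≤radius {d₁} {d₂} {r₁} {r₂} d≤r balanced = ≮⇒≥ λ r₁<d₁ →
  let d₂<r₂ : d₂ < r₂
      d₂<r₂ = +-cancelˡ-< r₁ d₂ r₂ (≤-trans (+-monoˡ-≤ d₂ r₁<d₁) d≤r)
  in <-irrefl refl (begin-strict
    suc (d₂ + r₁)   ≡⟨ +-comm (suc d₂) r₁ ⟩
    r₁ + suc d₂     <⟨ +-mono-≤ r₁<d₁ d₂<r₂ ⟩
    d₁ + r₂         ≤⟨ balanced ⟩
    suc (d₂ + r₁)   ∎)
  where open ≤-Reasoning

balanced⇒prefix-closer : ∀ {t d₁ d₂ b r₁ r₂} → t < d₁ → d₁ + d₂ ≤ t + b →
                         d₁ + r₂ ≤ suc (d₂ + r₁) → t + r₂ < b + r₁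
balanced⇒prefix-closer {t} {d₁} {d₂} {b} {r₁} {r₂} t<d₁ d≤t+b balanced = begin-strict
  t + r₂    ≤⟨ ≤-pred (≤-trans (+-monoˡ-≤ r₂ t<d₁) balanced) ⟩
  d₂ + r₁   <⟨ +-monoˡ-< r₁ d₂<b ⟩
  b + r₁    ∎
  where
  open ≤-Reasoning
  d₂<b : d₂ < b
  d₂<b = +-cancelˡ-< t d₂ b (≤-trans (+-monoˡ-≤ d₂ t<d₁) d≤t+b)

detour-≤ : ∀ {b t d₁ r₁ r₂} → b + r₁ ≤ t + r₂ → t ≤ d₁ → d₁ ≤ r₁ → b + (d₁ ∸ t) ≤ r₂
detour-≤ {b} {t} {d₁} {r₁} {r₂} b+r₁≤t+r₂ t≤d₁ d₁≤r₁ = +-cancelʳ-≤ t (b + (d₁ ∸ t)) r₂ (begin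
  b + (d₁ ∸ t) + t   ≡⟨ +-assoc b (d₁ ∸ t) t ⟩
  b + (d₁ ∸ t + t)   ≡⟨ cong (λ m → b + m) (m∸n+n≡m t≤d₁) ⟩
  b + d₁             ≤⟨ +-monoʳ-≤ b d₁≤r₁ ⟩
  b + r₁             ≤⟨ b+r₁≤t+r₂ ⟩
  t + r₂             ≡⟨ +-comm t r₂ ⟩
  r₂ + t             ∎)
  where open ≤-Reasoning

module Cells (G : Graph) {n : ℕ} (s : Fin n → Fin (N G)) (r : Fin n → ℕ) where

  -- d(s_i,v) − r_i < d(s_k,v) − r_k for a = d(s_i,v), b = d(s_k,v), written without
  -- subtraction; ties go to the smaller index.
  Closer : Fin n → ℕ → Fin n → ℕ → Set
  Closer i a k b = a + r k < b + r i ⊎ (a + r k ≡ b + r i × toℕ i < toℕ k)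

  Closer-asym : ∀ {i k a b} → Closer i a k b → ¬ Closer k b i a
  Closer-asym (inj₁ lt)        (inj₁ gt)        = <-asym lt gt
  Closer-asym (inj₁ lt)        (inj₂ (eq , _))  = <-irrefl (sym eq) lt
  Closer-asym (inj₂ (eq , _))  (inj₁ gt)        = <-irrefl (sym eq) gt
  Closer-asym (inj₂ (_ , i<k)) (inj₂ (_ , k<i)) = <-asym i<k k<i

  Nearest : Fin n → Fin (N G) → Set
  Nearest i v = Σ ℕ λ a → Dist G (s i) v a × (∀ k → k ≢ i → ∀ b → Dist G (s k) v b → Closer i a k b)

  -- With equal balls around distinct centres, s_i need not be nearest to itself.
  Cell : Fin n → Fin (N G) → Set
  Cell i v = (∀ k → v ≡ s k → k ≡ i) × (v ≡ s i ⊎ Nearest i v)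

  Cell-disjoint : ∀ {i k v} → Cell i v → Cell k v → i ≡ k
  Cell-disjoint (_ , inj₁ v≡sᵢ) (centreₖ , _) = centreₖ _ v≡sᵢ
  Cell-disjoint (centreᵢ , _) (_ , inj₁ v≡sₖ) = sym (centreᵢ _ v≡sₖ)
  Cell-disjoint {i} {k} (_ , inj₂ (a , Dᵢ , winsᵢ)) (_ , inj₂ (b , Dₖ , winsₖ)) with i ≟ᶠ k
  ... | yes i≡k = i≡k
  ... | no  i≢k = ⊥-elim (Closer-asym (winsᵢ k (≢-sym i≢k) b Dₖ) (winsₖ i i≢k a Dᵢ))

module Medians (G : Graph) {n : ℕ} (s : Fin n → Fin (N G)) (r : Fin n → ℕ)
  (s-injective : ∀ i j → s i ≡ s j → i ≡ j)
  (incomparable : ∀ i j → i ≢ j → Incomparable G (s i , r i) (s j , r j)) where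

  open Walks G
  open Cells G s r

  private
    V = Fin (N G)

  record MedianPath (i j : Fin n) : Set where
    field
      x         : V
      d₁ d₂     : ℕ
      to-x₁     : Dist G (s i) x d₁
      to-x₂     : Dist G (s j) x d₂
      geodesic  : ∀ {m} → Walk G (s i) (s j) m → d₁ + d₂ ≤ m
      balanced₁ : d₁ + r j ≤ suc (d₂ + r i)
      balanced₂ : d₂ + r i ≤ suc (d₁ + r j)
      within₁   : d₁ ≤ r i
      within₂   : d₂ ≤ r j
      private-x : ∀ k → InBall G (s k) (r k) x → k ≡ i ⊎ k ≡ j
      distinct  : i ≢ j

    path : Walk G (s i) x d₁
    path = proj₁ to-x₁

  swap : ∀ {i j} → MedianPath i j → MedianPath j i
  swap g = record
    { x = x ; d₁ = d₂ ; d₂ = d₁ ; to-x₁ = to-x₂ ; to-x₂ = to-x₁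
    ; geodesic  = λ {m} w → subst (_≤ m) (+-comm d₁ d₂) (geodesic (reverse w))
    ; balanced₁ = balanced₂ ; balanced₂ = balanced₁
    ; within₁ = within₂ ; within₂ = within₁
    ; private-x = λ k k∈B → Data.Sum.swap (private-x k k∈B)
    ; distinct  = ≢-sym distinct
    }
    where
    open MedianPath g
    import Data.Sum

  centre-Cell : ∀ i → Cell i (s i)
  centre-Cell i = (λ k sᵢ≡sₖ → s-injective k i (sym sᵢ≡sₖ)) , inj₁ refl

  module _ {i j} (g : MedianPath i j) where
    open MedianPath g

    closer-than-others : ∀ {t k b} → t ≤ d₁ → k ≢ i → k ≢ j → Dist G (s k) (at path t) b →
                         t + r k < b + r i
    closer-than-others {t} {k} {b} t≤d₁ k≢i k≢j D =
      decidable-stable (t + r k <? b + r i) λ t+rₖ≮b+rᵢ →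
        walk⇒¬¬InBall (proj₁ D ++ suffix path t t≤d₁) (detour-≤ (≮⇒≥ t+rₖ≮b+rᵢ) t≤d₁ within₁)
        λ x∈Bₖ → [ k≢i , k≢j ]′ (private-x k x∈Bₖ)

    closer-than-j : ∀ {t b} → t < d₁ → Dist G (s j) (at path t) b → t + r j < b + r i
    closer-than-j {t} t<d₁ D = balanced⇒prefix-closer t<d₁
      (geodesic (prefix path t (<⇒≤ t<d₁) ++ reverse (proj₁ D))) balanced₁

    prefix-to : ∀ {t v} → t ≤ d₁ → at path t ≡ v → Walk G (s i) v t
    prefix-to {t} t≤d₁ refl = prefix path t t≤d₁

    not-centre-before : ∀ {t} → t < d₁ → ∀ k → at path t ≡ s k → k ≡ i
    not-centre-before {t} t<d₁ k vₜ≡sₖ with k ≟ᶠ i | k ≟ᶠ j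
    ... | yes k≡i | _        = k≡i
    ... | no  _   | yes refl = ⊥-elim (<-irrefl refl
          (<-≤-trans t<d₁ (≤-trans (m≤m+n d₁ d₂) (geodesic (prefix-to (<⇒≤ t<d₁) vₜ≡sₖ)))))
    ... | no  k≢i | no  k≢j = ⊥-elim (walk⇒¬¬⊊B (prefix-to (<⇒≤ t<d₁) vₜ≡sₖ) (<⇒≤ closer)
          (d₁ , to-x₁ , within₁) (λ x∈Bₖ → [ k≢i , k≢j ]′ (private-x k x∈Bₖ))
          λ Bₖ⊊Bᵢ → incomparable i k (≢-sym k≢i) (inj₂ Bₖ⊊Bᵢ))
      where
      closer : t + r k < 0 + r i
      closer = closer-than-others (<⇒≤ t<d₁) k≢i k≢j (≡⇒Dist0 (sym vₜ≡sₖ))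

    cell-before : ∀ {t} → t < d₁ → Cell i (at path t)
    cell-before {t} t<d₁ = not-centre-before t<d₁ ,
      inj₂ (t , Dist-prefix to-x₁ t (<⇒≤ t<d₁) , λ k k≢i b D → inj₁ (closer k k≢i D))
      where
      closer : ∀ k → k ≢ i → ∀ {b} → Dist G (s k) (at path t) b → t + r k < b + r i
      closer k k≢i D with k ≟ᶠ j
      ... | yes refl = closer-than-j t<d₁ D
      ... | no  k≢j  = closer-than-others (<⇒≤ t<d₁) k≢i k≢j D

    x-not-centre : x ≢ s i → x ≢ s j → ∀ k → x ≢ s k
    x-not-centre x≢sᵢ x≢sⱼ k x≡sₖ
      with private-x k (0 , ≡⇒Dist0 (sym x≡sₖ) , z≤n)
    ... | inj₁ refl = x≢sᵢ x≡sₖ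
    ... | inj₂ refl = x≢sⱼ x≡sₖ

    closer⇒x-Cell : (∀ k → x ≢ s k) → Closer i d₁ j d₂ → Cell i x
    closer⇒x-Cell x≢s closer = (λ k x≡sₖ → ⊥-elim (x≢s k x≡sₖ)) , inj₂ (d₁ , to-x₁ , nearest)
      where
      nearest : ∀ k → k ≢ i → ∀ b → Dist G (s k) x b → Closer i d₁ k b
      nearest k k≢i b D with k ≟ᶠ j
      ... | yes refl = subst (Closer i d₁ j) (Dist-unique to-x₂ D) closer
      ... | no  k≢j  = inj₁ (closer-than-others ≤-refl k≢i k≢j
                               (subst (λ v → Dist G (s k) v b) (sym (at-end path)) D))

    OnBranch : V → Set
    OnBranch v = Σ ℕ λ t → t ≤ d₁ × (t < d₁ ⊎ Cell i x) × at path t ≡ v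

    OnBranch⇒Cell : ∀ {v} → OnBranch v → Cell i v
    OnBranch⇒Cell (t , _ , inj₁ t<d₁ , refl) = cell-before t<d₁
    OnBranch⇒Cell (t , t≤d₁ , inj₂ x-cell , refl) with m≤n⇒m<n∨m≡n t≤d₁
    ... | inj₁ t<d₁ = cell-before t<d₁
    ... | inj₂ refl = subst (Cell i) (sym (at-end path)) x-cell

    OnBranch-walk : ∀ {P : V → Set} → (∀ {v} → OnBranch v → P v) →
                    ∀ {v} → OnBranch v → WalkIn G P (s i) v
    OnBranch-walk on⇒P (t , t≤d₁ , owned , refl) = prefix-in path t t≤d₁ λ t′ t′≤t →
      on⇒P (t′ , ≤-trans t′≤t t≤d₁ , Data.Sum.map₁ (≤-<-trans t′≤t) owned , refl)
      where import Data.Sum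

  module _ {i j} (g : MedianPath i j) where
    open MedianPath g

    closest-cell : (∀ k → x ≢ s k) → Cell i x ⊎ Cell j x
    closest-cell x≢s with <-cmp (d₁ + r j) (d₂ + r i)
    ... | tri< lt _ _ = inj₁ (closer⇒x-Cell g x≢s (inj₁ lt))
    ... | tri> _ _ gt = inj₂ (closer⇒x-Cell (swap g) x≢s (inj₁ gt))
    ... | tri≈ _ eq _ with <-cmp (toℕ i) (toℕ j)
    ...   | tri< lt _ _  = inj₁ (closer⇒x-Cell g x≢s (inj₂ (eq , lt)))
    ...   | tri> _ _ gt  = inj₂ (closer⇒x-Cell (swap g) x≢s (inj₂ (sym eq , gt)))
    ...   | tri≈ _ i≡j _ = ⊥-elim (distinct (toℕ-injective i≡j))

    median-cell : Cell i x ⊎ Cell j x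
    median-cell with x ≟ᶠ s i | x ≟ᶠ s j
    ... | yes x≡sᵢ | _        = inj₁ (subst (Cell i) (sym x≡sᵢ) (centre-Cell i))
    ... | no  _    | yes x≡sⱼ = inj₂ (subst (Cell j) (sym x≡sⱼ) (centre-Cell j))
    ... | no  x≢sᵢ | no  x≢sⱼ = closest-cell (x-not-centre g x≢sᵢ x≢sⱼ)

    edge-across : Cell i x → ∃ λ u → ∃ λ v → OnBranch g u × OnBranch (swap g) v × _~_ G u v
    edge-across x-cell@(x-centre , _)
      with penultimate (proj₁ to-x₂) (λ sⱼ≡x → distinct (sym (x-centre j (sym sⱼ≡x))))
    ... | t , t<d₂ , edge = x , at (proj₁ to-x₂) t ,
      (d₁ , ≤-refl , inj₂ x-cell , at-end path) , (t , <⇒≤ t<d₂ , inj₁ t<d₂ , refl) , ~-sym G edge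

  median-path : ∀ {i j x} → i ≢ j → Intersecting G (s i , r i) (s j , r j) →
                IsMedian G (s i , r i) (s j , r j) x →
                (∀ k → InBall G (s k) (r k) x → k ≡ i ⊎ k ≡ j) → MedianPath i j
  median-path {i} {j} {x} i≢j (_ , (a , Dₐ , a≤rᵢ) , (b , D_b , b≤rⱼ))
              (_ , d₁ , d₂ , D , D₁ , D₂ , refl , rounding) private-x = record
    { x = x ; d₁ = d₁ ; d₂ = d₂ ; to-x₁ = D₁ ; to-x₂ = D₂
    ; geodesic = proj₂ D _
    ; balanced₁ = balanced₁ ; balanced₂ = balanced₂
    ; within₁ = balanced⇒≤radius d≤r balanced₁
    ; within₂ = balanced⇒≤radius (subst₂ _≤_ (+-comm d₁ d₂) (+-comm (r i) (r j)) d≤r) balanced₂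
    ; private-x = private-x ; distinct = i≢j
    }
    where
    z : ℤ
    z = (+ r i ℤ.- + r j) ℤ.+ + (d₁ + d₂)
    near : NearHalf (+ d₁) z
    near = [ (λ (d₁≡ , _) → subst (λ q → NearHalf q z) (sym d₁≡) (⌊/2⌋-NearHalf z))
           , (λ (d₁≡ , _) → subst (λ q → NearHalf q z) (sym d₁≡) (⌈/2⌉-NearHalf z)) ]′ rounding
    balanced₁ : d₁ + r j ≤ suc (d₂ + r i)
    balanced₁ = proj₁ (NearHalf⇒balanced d₁ d₂ (r i) (r j) near)
    balanced₂ : d₂ + r i ≤ suc (d₁ + r j)
    balanced₂ = proj₂ (NearHalf⇒balanced d₁ d₂ (r i) (r j) near)
    d≤r : d₁ + d₂ ≤ r i + r j
    d≤r = ≤-trans (proj₂ D _ (proj₁ Dₐ ++ reverse (proj₁ D_b))) (+-mono-≤ a≤rᵢ b≤rⱼ)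

module BranchSets (G : Graph) {n : ℕ} (s : Fin n → Fin (N G)) (r : Fin n → ℕ)
  (s-injective : ∀ i j → s i ≡ s j → i ≡ j)
  (incomparable : ∀ i j → i ≢ j → Incomparable G (s i , r i) (s j , r j))
  (E : Fin n → Fin n → Set) (E-irr : ∀ {i} → ¬ E i i)
  (intersecting : ∀ i j → E i j → Intersecting G (s i , r i) (s j , r j))
  (median : ∀ i j → E i j → Σ (Fin (N G)) λ x →
     IsMedian G (s i , r i) (s j , r j) x × (∀ k → InBall G (s k) (r k) x → k ≡ i ⊎ k ≡ j))
  where

  open Walks G
  open Cells G s r
  open Medians G s r s-injective incomparable

  private
    V = Fin (N G)

  edge-path : ∀ {i j} → E i j ⊎ E j i → MedianPath i j
  edge-path {i} {j} (inj₁ e) =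
    median-path (λ { refl → E-irr e }) (intersecting i j e)
                (proj₁ (proj₂ (median i j e))) (proj₂ (proj₂ (median i j e)))
  edge-path (inj₂ e) = swap (edge-path (inj₁ e))

  Branch : Fin n → V → Set
  Branch i v = v ≡ s i ⊎ ∃ λ j → Σ (E i j ⊎ E j i) λ e → OnBranch (edge-path e) v

  Branch⇒Cell : ∀ {i v} → Branch i v → Cell i v
  Branch⇒Cell {i} (inj₁ refl)          = centre-Cell i
  Branch⇒Cell     (inj₂ (_ , e , on)) = OnBranch⇒Cell (edge-path e) on

  Branch-walk : ∀ {i v} → Branch i v → WalkIn G (Branch i) (s i) v
  Branch-walk (inj₁ refl)         = [] (inj₁ refl)
  Branch-walk (inj₂ (j , e , on)) = OnBranch-walk (edge-path e) (λ on′ → inj₂ (j , e , on′)) on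

  Branch-edge : ∀ i j → E i j → ∃ λ u → ∃ λ v → Branch i u × Branch j v × _~_ G u v
  Branch-edge i j e with median-cell (edge-path (inj₁ e))
  ... | inj₁ x-cell =
    let u , v , on-u , on-v , u∼v = edge-across (edge-path (inj₁ e)) x-cell
    in u , v , inj₂ (j , inj₁ e , on-u) , inj₂ (i , inj₂ e , on-v) , u∼v
  ... | inj₂ x-cell =
    -- on-v : OnBranch (swap (swap g)) v, which is definitionally OnBranch g v
    let u , v , on-u , on-v , u∼v = edge-across (swap (edge-path (inj₁ e))) x-cell
    in v , u , inj₂ (j , inj₁ e , on-v) , inj₂ (i , inj₂ e , on-u) , ~-sym G u∼v

lemma2p1 : (G : Graph) (n : ℕ) (s : Fin n → Fin (N G)) (r : Fin n → ℕ) →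
    -- pairwise distinct centers
    (∀ i j → s i ≡ s j → i ≡ j) →
    -- pairwise incomparable balls
    (∀ i j → i ≢ j → Incomparable G (s i , r i) (s j , r j)) →
    -- E_S : a set of pairs of distinct balls of S (symmetric, irreflexive)
    (E : Fin n → Fin n → Set) →
    (E-sym : ∀ {i j} → E i j → E j i) → (E-irr : ∀ {i} → ¬ E i i) →
    -- each pair in E_S consists of intersecting balls
    (∀ i j → E i j → Intersecting G (s i , r i) (s j , r j)) →
    -- each pair in E_S has a median vertex contained in no other ball of S
    (∀ i j → E i j → Σ (Fin (N G)) λ x →
        IsMedian G (s i , r i) (s j , r j) x ×
        (∀ k → InBall G (s k) (r k) x → k ≡ i ⊎ k ≡ j)) →
    IsMinor (mkGraph n E E-sym E-irr) G
lemma2p1 G n s r s-injective incomparable E _ E-irr intersecting median =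
  Branch ,
  (λ i → s i , inj₁ refl) ,
  (λ i j v in-i in-j → Cell-disjoint (Branch⇒Cell in-i) (Branch⇒Cell in-j)) ,
  (λ i u v in-u in-v → ++-in (reverse-in (Branch-walk in-u)) (Branch-walk in-v)) ,
  Branch-edge
  where
  open Walks G
  open Cells G s r
  open BranchSets G s r s-injective incomparable E E-irr intersecting median
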